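{- Let $\theta\ge 0$ be an integer and consider the two-color (black/white) urn with replacement matrix $$\begin{pmatrix} \mathcal{U} & \theta-\mathcal{U}\\ \theta-\mathcal{U} & \mathcal{U}\end{pmatrix},$$ where $\mathcal{U}$ is uniformly distributed on $\{0,1,\dots,\theta\}$, started from a deterministic nonempty configuration $(B_0,W_0)=(b_0,w_0)$. Then for every $n\ge0$ the number $B_n$ of black balls after $n$ draws satisfies $$\Pr(B_n=b)=\frac{T_{\theta,n,b-b_0}}{(\theta+1)^n},\qquad b\in\{b_0,b_0+1,\dots,b_0+\theta n\},$$ where $T_{\theta,n,k}=[x^k]\,(1+x+\cdots+x^{\theta})^n$.
   Context: At each step a ball is drawn uniformly at random and put back, and an independent fresh realization $k$ of $\mathcal{U}$ is generated. If the drawn ball is black, $k$ black balls and $\theta-k$ white balls are added; if it is white, $\theta-k$ black balls and $k$ white balls are added. $[x^k]F(x)$ denotes the coefficient of $x^k$ in the polynomial $F$. -}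

module Defs where

open import Data.Nat using (ℕ; zero; suc; _+_; _*_; _∸_; _^_; NonZero; _≡ᵇ_)
open import Data.Nat.Properties using (m^n≢0)
open import Data.Integer using (+_)
open import Data.Rational using (ℚ; _/_; 0ℚ; 1ℚ) renaming (_+_ to _+ℚ_; _*_ to _*ℚ_)
open import Data.List using (List; []; _∷_; map; foldr; upTo; replicate)
open import Data.Bool using (if_then_else_)

-- Polynomials with natural coefficients as coefficient lists
-- (index i = coefficient of x^i).

addP : List ℕ → List ℕ → List ℕ
addP [] q = q
addP p [] = p
addP (a ∷ p) (b ∷ q) = (a + b) ∷ addP p q

mulP : List ℕ → List ℕ → List ℕ
mulP [] q = []
mulP (a ∷ p) q = addP (map (a *_) q) (0 ∷ mulP p q)

powP : List ℕ → ℕ → List ℕ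
powP p zero = 1 ∷ []
powP p (suc n) = mulP p (powP p n)

coeff : ℕ → List ℕ → ℕ
coeff k [] = 0
coeff zero (a ∷ p) = a
coeff (suc k) (a ∷ p) = coeff k p

T : ℕ → ℕ → ℕ → ℕ
T θ n k = coeff k (powP (replicate (suc θ) 1) n)

-- a / m as a rational, with the (unreachable) convention a / 0 = 0.
frac : ℕ → ℕ → ℚ
frac a zero = 0ℚ
frac a (suc m) = (+ a) / suc m

sumℚ : List ℚ → ℚ
sumℚ = foldr _+ℚ_ 0ℚ

-- urnProb θ n B W b = Pr(B_n = b) for the urn with replacement matrix
-- [[U, θ-U],[θ-U, U]], U uniform on {0,…,θ} (fresh at each step),
-- started from the deterministic configuration (B_0, W_0) = (B, W).
urnProb : (θ n B W b : ℕ) → ℚ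
urnProb θ zero B W b = if B ≡ᵇ b then 1ℚ else 0ℚ
urnProb θ (suc n) B W b =
  sumℚ (map (λ k →
    ((+ 1) / suc θ) *ℚ
      (  (frac B (B + W) *ℚ urnProb θ n (B + k) (W + (θ ∸ k)) b)
     +ℚ (frac W (B + W) *ℚ urnProb θ n (B + (θ ∸ k)) (W + k) b)))
    (upTo (suc θ)))

sucPowNonZero : ∀ θ n → NonZero (suc θ ^ n)
sucPowNonZero θ n = m^n≢0 (suc θ) n

module Submission where

-- Write Pₙ = (1 + x + ⋯ + x^θ)ⁿ and let shiftCoeff B b p be the
-- coefficient of x^b in x^B·p.  We prove, by induction on n, the stronger
-- invariant that for EVERY initial configuration (B , W) with B + W ≥ 1 and
-- every b,
--     urnProb θ n B W b = shiftCoeff B b Pₙ / (θ+1)ⁿ .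
-- In one step the next black count is B + k (black drawn) or B + (θ − k)
-- (white drawn).  Since k ↦ θ − k permutes {0,…,θ}, both colours lead to the
-- same average of the induction hypothesis over k, so the colour
-- probabilities (which sum to 1) drop out: the law of Bₙ does not depend on
-- W.  What remains is the identity  Σₖ shiftCoeff (B+k) b p
-- = shiftCoeff B b ((1 + ⋯ + x^θ)·p),  i.e. the recursion defining Pₙ₊₁.

open import Defs
open import Data.Nat using (ℕ; suc; _+_; _*_; _∸_; _^_; _≤_)
open import Data.Integer using (+_)
open import Data.Rational using (ℚ; _/_)
open import Relation.Binary.PropositionalEquality using (_≡_)

open import Data.Nat as ℕ using (zero; NonZero; s≤s)
import Data.Nat.Properties as ℕ
open import Data.Nat.ListAction using (sum)
import Data.Integer as ℤ
import Data.Integer.Properties as ℤ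
open import Data.Integer.Solver using (module +-*-Solver)
open import Data.Rational using (0ℚ; 1ℚ; fromℚᵘ) renaming (_+_ to _+ℚ_; _*_ to _*ℚ_)
open import Data.Rational.Properties as ℚ using (fromℚᵘ-toℚᵘ; toℚᵘ-fromℚᵘ; fromℚᵘ-cong; toℚᵘ-homo-+; toℚᵘ-homo-*; 0/n≡0)
open import Data.Rational.Unnormalised using (mkℚᵘ; *≡*) renaming (_+_ to _+ᵘ_; _*_ to _*ᵘ_; _≃_ to _≃ᵘ_)
import Data.Rational.Unnormalised.Properties as ℚᵘ
import Data.Rational.Solver as ℚ-Solver
open import Data.List using (List; []; _∷_; _∷ʳ_; map; upTo; replicate; applyUpTo; applyDownFrom)
open import Data.List.Properties using (map-cong; map-id; map-upTo; applyUpTo-∷ʳ)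
open import Data.List.Relation.Binary.Permutation.Propositional using (_↭_; ↭-refl; ↭-trans; ↭-prep; ↭⇒↭ₛ)
open import Data.List.Relation.Binary.Permutation.Propositional.Properties using (∷↭∷ʳ)
open import Data.List.Relation.Binary.Permutation.Setoid.Properties using (foldr-commMonoid)
open import Data.Empty.Irrelevant using (⊥-elim)
open import Data.Bool using (if_then_else_)
open import Function using (_∘_)
open import Relation.Binary.PropositionalEquality using (refl; sym; trans; cong; cong₂; subst; setoid; module ≡-Reasoning)

fromℚᵘ-+ : ∀ u v → fromℚᵘ u +ℚ fromℚᵘ v ≡ fromℚᵘ (u +ᵘ v)
fromℚᵘ-+ u v = trans (sym (fromℚᵘ-toℚᵘ _)) (fromℚᵘ-cong
  (ℚᵘ.≃-trans (toℚᵘ-homo-+ (fromℚᵘ u) (fromℚᵘ v)) (ℚᵘ.+-cong (toℚᵘ-fromℚᵘ u) (toℚᵘ-fromℚᵘ v))))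

fromℚᵘ-* : ∀ u v → fromℚᵘ u *ℚ fromℚᵘ v ≡ fromℚᵘ (u *ᵘ v)
fromℚᵘ-* u v = trans (sym (fromℚᵘ-toℚᵘ _)) (fromℚᵘ-cong
  (ℚᵘ.≃-trans (toℚᵘ-homo-* (fromℚᵘ u) (fromℚᵘ v)) (ℚᵘ.*-cong (toℚᵘ-fromℚᵘ u) (toℚᵘ-fromℚᵘ v))))

+-/-common : ∀ a b N .{{_ : NonZero N}} → (+ a / N) +ℚ (+ b / N) ≡ + (a + b) / N
+-/-common a b zero {{nz}} = ⊥-elim (NonZero.nonZero nz)
+-/-common a b (suc d) = trans (fromℚᵘ-+ (mkℚᵘ (+ a) d) (mkℚᵘ (+ b) d)) (fromℚᵘ-cong sumᵘ)
  where
  open +-*-Solver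
  D = suc d
  sumᵘ : mkℚᵘ (+ a) d +ᵘ mkℚᵘ (+ b) d ≃ᵘ mkℚᵘ (+ (a + b)) d
  sumᵘ = *≡* cross
    where
    cross : ((+ a ℤ.* + D) ℤ.+ (+ b ℤ.* + D)) ℤ.* + D ≡ + (a + b) ℤ.* + (D * D)
    cross rewrite ℤ.pos-* D D | ℤ.pos-+ a b =
      solve 3 (λ x y z → (x :* z :+ y :* z) :* z := (x :+ y) :* (z :* z)) refl (+ a) (+ b) (+ D)

1/-*-/ : ∀ h M N .{{_ : NonZero M}} .{{_ : NonZero N}} →
  (+ 1 / M) *ℚ (+ h / N) ≡ _/_ (+ h) (M * N) {{ℕ.m*n≢0 M N}}
1/-*-/ h zero N {{nz}} = ⊥-elim (NonZero.nonZero nz)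
1/-*-/ h (suc t) zero {{_}} {{nz}} = ⊥-elim (NonZero.nonZero nz)
1/-*-/ h (suc t) (suc e) = trans (fromℚᵘ-* (mkℚᵘ (+ 1) t) (mkℚᵘ (+ h) e)) (fromℚᵘ-cong productᵘ)
  where
  productᵘ : mkℚᵘ (+ 1) t *ᵘ mkℚᵘ (+ h) e ≃ᵘ mkℚᵘ (+ h) (ℕ.pred (suc t * suc e))
  productᵘ = *≡* (cong (ℤ._* + (suc t * suc e)) (ℤ.*-identityˡ (+ h)))

n/n≡1 : ∀ N .{{_ : NonZero N}} → + N / N ≡ 1ℚ
n/n≡1 zero {{nz}} = ⊥-elim (NonZero.nonZero nz)
n/n≡1 (suc s) = fromℚᵘ-cong {mkℚᵘ (+ suc s) s} {mkℚᵘ (+ 1) 0}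
  (*≡* (trans (ℤ.*-identityʳ (+ suc s)) (sym (ℤ.*-identityˡ (+ suc s)))))

draw-probabilities-sum : ∀ B W → 1 ≤ B + W → frac B (B + W) +ℚ frac W (B + W) ≡ 1ℚ
draw-probabilities-sum B W nonempty with B + W in total
... | suc s = trans (+-/-common B W (suc s)) (trans (cong (λ m → + m / suc s) total) (n/n≡1 (suc s)))

open ℚ-Solver.+-*-Solver using (solve; _:+_; _:*_; _:=_; con)

sum-*ˡ : ∀ u (f : ℕ → ℚ) ks → sumℚ (map (λ k → u *ℚ f k) ks) ≡ u *ℚ sumℚ (map f ks)
sum-*ˡ u f [] = sym (ℚ.*-zeroʳ u)
sum-*ˡ u f (k ∷ ks) = trans (cong (u *ℚ f k +ℚ_) (sum-*ˡ u f ks)) (sym (ℚ.*-distribˡ-+ u (f k) _))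

sum-linear : ∀ x y (f g : ℕ → ℚ) ks →
  sumℚ (map (λ k → x *ℚ f k +ℚ y *ℚ g k) ks) ≡ x *ℚ sumℚ (map f ks) +ℚ y *ℚ sumℚ (map g ks)
sum-linear x y f g [] = solve 2 (λ x y → con 0ℚ := x :* con 0ℚ :+ y :* con 0ℚ) refl x y
sum-linear x y f g (k ∷ ks) rewrite sum-linear x y f g ks =
  solve 6 (λ x y a b A B → (x :* a :+ y :* b) :+ (x :* A :+ y :* B) := x :* (a :+ A) :+ y :* (b :+ B))
    refl x y (f k) (g k) (sumℚ (map f ks)) (sumℚ (map g ks))

sum-↭ : ∀ {ps qs} → ps ↭ qs → sumℚ ps ≡ sumℚ qs
sum-↭ p = foldr-commMonoid (setoid ℚ) ℚ.+-0-isCommutativeMonoid (↭⇒↭ₛ p)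

sum-/ : ∀ (f : ℕ → ℕ) N .{{_ : NonZero N}} ks →
  sumℚ (map (λ k → + f k / N) ks) ≡ + sum (map f ks) / N
sum-/ f N [] = sym (0/n≡0 N)
sum-/ f N (k ∷ ks) = trans (cong (+ f k / N +ℚ_) (sum-/ f N ks)) (+-/-common (f k) _ N)

-- The reflection k ↦ m ∸ k permutes {0,…,m}: listed in order it is the
-- descending enumeration, which is the reverse of the ascending one.
applyDownFrom↭applyUpTo : ∀ {A : Set} (f : ℕ → A) n → applyDownFrom f n ↭ applyUpTo f n
applyDownFrom↭applyUpTo f zero = ↭-refl
applyDownFrom↭applyUpTo f (suc n) =
  ↭-trans (↭-prep (f n) (applyDownFrom↭applyUpTo f n))
    (↭-trans (∷↭∷ʳ (f n) (applyUpTo f n)) (subst (applyUpTo f n ∷ʳ f n ↭_) (applyUpTo-∷ʳ f n) ↭-refl))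

reflect-applyUpTo : ∀ {A : Set} (f : ℕ → A) m → applyUpTo (λ k → f (m ∸ k)) (suc m) ≡ applyDownFrom f (suc m)
reflect-applyUpTo f zero = refl
reflect-applyUpTo f (suc m) = cong (f (suc m) ∷_) (reflect-applyUpTo f m)

sum-reflect : ∀ (f : ℕ → ℚ) m → sumℚ (map (λ k → f (m ∸ k)) (upTo (suc m))) ≡ sumℚ (map f (upTo (suc m)))
sum-reflect f m = begin
  sumℚ (map (λ k → f (m ∸ k)) (upTo (suc m))) ≡⟨ cong sumℚ (trans (map-upTo (λ k → f (m ∸ k)) (suc m)) (reflect-applyUpTo f m)) ⟩
  sumℚ (applyDownFrom f (suc m))               ≡⟨ sum-↭ (applyDownFrom↭applyUpTo f (suc m)) ⟩
  sumℚ (applyUpTo f (suc m))                   ≡⟨ cong sumℚ (sym (map-upTo f (suc m))) ⟩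
  sumℚ (map f (upTo (suc m)))                  ∎
  where open ≡-Reasoning

-- shiftCoeff B b p = [x^b] (x^B · p): the coefficient of x^(b ∸ B) in p if
-- B ≤ b, and 0 otherwise.
shiftCoeff : ℕ → ℕ → List ℕ → ℕ
shiftCoeff zero    b       p = coeff b p
shiftCoeff (suc B) zero    p = 0
shiftCoeff (suc B) (suc b) p = shiftCoeff B b p

shiftCoeff-≤ : ∀ {B b} p → B ≤ b → shiftCoeff B b p ≡ coeff (b ∸ B) p
shiftCoeff-≤ {zero} p _ = refl
shiftCoeff-≤ {suc B} {suc b} p (s≤s B≤b) = shiftCoeff-≤ {B} {b} p B≤b

shiftCoeff-[] : ∀ B b → shiftCoeff B b [] ≡ 0
shiftCoeff-[] zero    b       = refl
shiftCoeff-[] (suc B) zero    = refl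
shiftCoeff-[] (suc B) (suc b) = shiftCoeff-[] B b

shiftCoeff-0∷ : ∀ B b p → shiftCoeff B b (0 ∷ p) ≡ shiftCoeff (suc B) b p
shiftCoeff-0∷ zero    zero    p = refl
shiftCoeff-0∷ zero    (suc b) p = refl
shiftCoeff-0∷ (suc B) zero    p = refl
shiftCoeff-0∷ (suc B) (suc b) p = shiftCoeff-0∷ B b p

coeff-addP : ∀ d p q → coeff d (addP p q) ≡ coeff d p + coeff d q
coeff-addP d       []      q       = refl
coeff-addP d       (a ∷ p) []      = sym (ℕ.+-identityʳ _)
coeff-addP zero    (a ∷ p) (b ∷ q) = refl
coeff-addP (suc d) (a ∷ p) (b ∷ q) = coeff-addP d p q

shiftCoeff-addP : ∀ B b p q → shiftCoeff B b (addP p q) ≡ shiftCoeff B b p + shiftCoeff B b q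
shiftCoeff-addP zero    b       p q = coeff-addP b p q
shiftCoeff-addP (suc B) zero    p q = refl
shiftCoeff-addP (suc B) (suc b) p q = shiftCoeff-addP B b p q

shiftCoeff-mulOnes : ∀ m p B b →
  shiftCoeff B b (mulP (replicate m 1) p) ≡ sum (applyUpTo (λ k → shiftCoeff (B + k) b p) m)
shiftCoeff-mulOnes zero p B b = shiftCoeff-[] B b
shiftCoeff-mulOnes (suc m) p B b = begin
  shiftCoeff B b (addP (map (1 *_) p) (0 ∷ mulP (replicate m 1) p))
    ≡⟨ shiftCoeff-addP B b _ _ ⟩
  shiftCoeff B b (map (1 *_) p) + shiftCoeff B b (0 ∷ mulP (replicate m 1) p)
    ≡⟨ cong₂ _+_ (cong (shiftCoeff B b) (trans (map-cong ℕ.*-identityˡ p) (map-id p))) (shiftCoeff-0∷ B b _) ⟩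
  shiftCoeff B b p + shiftCoeff (suc B) b (mulP (replicate m 1) p)
    ≡⟨ cong₂ _+_ (cong (λ B′ → shiftCoeff B′ b p) (sym (ℕ.+-identityʳ B))) (shiftCoeff-mulOnes m p (suc B) b) ⟩
  shiftCoeff (B + 0) b p + sum (applyUpTo (λ k → shiftCoeff (suc B + k) b p) m)
    ≡⟨ cong (λ ks → shiftCoeff (B + 0) b p + sum ks)
         (applyUpTo-cong (λ k → cong (λ B′ → shiftCoeff B′ b p) (sym (ℕ.+-suc B k))) m) ⟩
  sum (applyUpTo (λ k → shiftCoeff (B + k) b p) (suc m))
    ∎
  where
  open ≡-Reasoning
  applyUpTo-cong : ∀ {f g : ℕ → ℕ} → (∀ k → f k ≡ g k) → ∀ n → applyUpTo f n ≡ applyUpTo g n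
  applyUpTo-cong {f} {g} f≗g n = trans (sym (map-upTo f n)) (trans (map-cong f≗g (upTo n)) (map-upTo g n))

module Law (θ : ℕ) where

  P : ℕ → List ℕ
  P n = powP (replicate (suc θ) 1) n

  law : ℕ → ℕ → ℕ → ℚ
  law n B b = _/_ (+ shiftCoeff B b (P n)) (suc θ ^ n) {{sucPowNonZero θ n}}

  law-zero : ∀ B b → (if B ℕ.≡ᵇ b then 1ℚ else 0ℚ) ≡ law 0 B b
  law-zero zero    zero    = refl
  law-zero zero    (suc b) = refl
  law-zero (suc B) zero    = refl
  law-zero (suc B) (suc b) = law-zero B b

  -- One step of the urn, applied to any function G of the added black
  -- balls: by the reflection k ↦ θ ∸ k both colours give the same sum, so
  -- the colour probabilities x and y drop out once x + y = 1.
  step-average : ∀ (G : ℕ → ℚ) x y → x +ℚ y ≡ 1ℚ →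
    sumℚ (map (λ k → (+ 1 / suc θ) *ℚ (x *ℚ G k +ℚ y *ℚ G (θ ∸ k))) (upTo (suc θ)))
      ≡ (+ 1 / suc θ) *ℚ sumℚ (map G (upTo (suc θ)))
  step-average G x y x+y≡1 = begin
    sumℚ (map (λ k → u *ℚ (x *ℚ G k +ℚ y *ℚ G (θ ∸ k))) ks)
      ≡⟨ sum-*ˡ u _ ks ⟩
    u *ℚ sumℚ (map (λ k → x *ℚ G k +ℚ y *ℚ G (θ ∸ k)) ks)
      ≡⟨ cong (u *ℚ_) (sum-linear x y G (G ∘ (θ ∸_)) ks) ⟩
    u *ℚ (x *ℚ S +ℚ y *ℚ sumℚ (map (G ∘ (θ ∸_)) ks))
      ≡⟨ cong (λ S′ → u *ℚ (x *ℚ S +ℚ y *ℚ S′)) (sum-reflect G θ) ⟩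
    u *ℚ (x *ℚ S +ℚ y *ℚ S)
      ≡⟨ cong (u *ℚ_) (sym (ℚ.*-distribʳ-+ S x y)) ⟩
    u *ℚ ((x +ℚ y) *ℚ S)
      ≡⟨ cong (λ z → u *ℚ (z *ℚ S)) x+y≡1 ⟩
    u *ℚ (1ℚ *ℚ S)
      ≡⟨ cong (u *ℚ_) (ℚ.*-identityˡ S) ⟩
    u *ℚ S
      ∎
    where
    open ≡-Reasoning
    u = + 1 / suc θ
    ks = upTo (suc θ)
    S = sumℚ (map G ks)

  -- Averaging the law over the θ+1 equally likely shifts is one more
  -- factor of 1 + x + ⋯ + x^θ.
  law-suc : ∀ n B b → (+ 1 / suc θ) *ℚ sumℚ (map (λ k → law n (B + k) b) (upTo (suc θ))) ≡ law (suc n) B b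
  law-suc n B b = begin
    (+ 1 / suc θ) *ℚ sumℚ (map (λ k → + c k / N) (upTo (suc θ)))
      ≡⟨ cong ((+ 1 / suc θ) *ℚ_) (sum-/ c N (upTo (suc θ))) ⟩
    (+ 1 / suc θ) *ℚ (+ sum (map c (upTo (suc θ))) / N)
      ≡⟨ 1/-*-/ (sum (map c (upTo (suc θ)))) (suc θ) N ⟩
    _/_ (+ sum (map c (upTo (suc θ)))) (suc θ * N) {{sucPowNonZero θ (suc n)}}
      ≡⟨ cong (λ m → _/_ (+ m) (suc θ * N) {{sucPowNonZero θ (suc n)}})
           (trans (cong sum (map-upTo c (suc θ))) (sym (shiftCoeff-mulOnes (suc θ) (P n) B b))) ⟩
    law (suc n) B b
      ∎
    where
    open ≡-Reasoning
    N = suc θ ^ n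
    instance
      N≢0 : NonZero N
      N≢0 = sucPowNonZero θ n
    c : ℕ → ℕ
    c k = shiftCoeff (B + k) b (P n)

  urnProb≡law : ∀ n B W → 1 ≤ B + W → ∀ b → urnProb θ n B W b ≡ law n B b
  urnProb≡law zero B W _ b = law-zero B b
  urnProb≡law (suc n) B W nonempty b = begin
    urnProb θ (suc n) B W b
      ≡⟨ cong sumℚ (map-cong (λ k → cong₂ (λ s t → u *ℚ (x *ℚ s +ℚ y *ℚ t))
           (urnProb≡law n (B + k) (W + (θ ∸ k)) (grown k (θ ∸ k)) b)
           (urnProb≡law n (B + (θ ∸ k)) (W + k) (grown (θ ∸ k) k) b)) (upTo (suc θ))) ⟩
    sumℚ (map (λ k → u *ℚ (x *ℚ G k +ℚ y *ℚ G (θ ∸ k))) (upTo (suc θ)))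
      ≡⟨ step-average G x y (draw-probabilities-sum B W nonempty) ⟩
    u *ℚ sumℚ (map G (upTo (suc θ)))
      ≡⟨ law-suc n B b ⟩
    law (suc n) B b
      ∎
    where
    open ≡-Reasoning
    u = + 1 / suc θ
    x = frac B (B + W)
    y = frac W (B + W)
    G : ℕ → ℚ
    G k = law n (B + k) b
    grown : ∀ i j → 1 ≤ (B + i) + (W + j)
    grown i j = ℕ.≤-trans nonempty (ℕ.+-mono-≤ (ℕ.m≤m+n B i) (ℕ.m≤m+n W j))

open Law using (urnProb≡law; P)

proposition3 : (θ b₀ w₀ : ℕ) → 1 ≤ b₀ + w₀ → (n b : ℕ) →
    b₀ ≤ b → b ≤ b₀ + θ * n →
    urnProb θ n b₀ w₀ b ≡ _/_ (+ T θ n (b ∸ b₀)) (suc θ ^ n) {{sucPowNonZero θ n}}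
proposition3 θ b₀ w₀ nonempty n b b₀≤b _ =
  trans (urnProb≡law θ n b₀ w₀ nonempty b)
    (cong (λ m → _/_ (+ m) (suc θ ^ n) {{sucPowNonZero θ n}}) (shiftCoeff-≤ (P θ n) b₀≤b))
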